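{- If a finite abelian network halts on all inputs, then it emulates some finite abelian processor.
   Context: $\mathbb{N}=\{0,1,2,\dots\}$. A processor with finite input alphabet $A$, finite output alphabet $B$ and finite state space $Q$ consists of transition maps $t_i:Q\to Q$ and output maps $o_i:Q\to\mathbb{N}^B$ ($i\in A$): on receiving letter $i$ in state $q$ it moves to $t_i(q)$ and emits $(o_i(q))_b$ copies of letter $b$. It is abelian if $t_it_j=t_jt_i$ and $o_i+o_j\circ t_i=o_j+o_i\circ t_j$ for all $i,j\in A$. A processor has an initial state $q^0$ from which every state is reachable by compositions of transition maps, and computes $F:\mathbb{N}^A\to\mathbb{N}^B$ giving the total output when, from $q^0$, it receives $x_a$ letters $a$ for each $a$. A finite abelian network is a finite directed multigraph with pairwise disjoint sets of dangling input edges (no tail), output edges and trash edges (no head); each node carries a finite abelian processor with an initial state, whose input alphabet is its set of incoming edges and output alphabet its set of outgoing edges. Given a vector of numbers of letters on the input edges, a run repeatedly picks any non-output, non-trash edge carrying a letter and feeds one letter to the processor at its head, which updates its state and places its emitted letters on its outgoing edges; the run halts if after finitely many steps all letters lie on output or trash edges. It is known that if some run halts then all runs halt, with the same final processor states and the same numbers of letters on output edges. The network halts on all inputs if this happens for every input vector; it then computes a function $\mathbb{N}^{\text{input edges}}\to\mathbb{N}^{\text{output edges}}$, and it emulates a processor if it computes the same function as that processor (identifying input edges with input letters and output edges with output letters). -}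

module Defs where

open import Data.Nat using (ℕ; zero; suc; _+_; _∸_; _<_)
open import Data.Fin using (Fin; _≟_)
open import Data.List using (List; []; _∷_; _++_; replicate; concatMap)
open import Data.List.Base using () renaming (allFin to allFinL)
open import Data.Product using (Σ; ∃; _×_; _,_)
open import Data.Sum using (_⊎_; inj₁; inj₂)
open import Data.Sum.Properties using (≡-dec)
open import Relation.Binary.PropositionalEquality using (_≡_; refl)
open import Relation.Nullary using (yes; no)

record Processor (A B : Set) : Set where
  field
    size  : ℕ
    trans : A → Fin size → Fin size
    out   : A → Fin size → B → ℕ
    init  : Fin size

module _ {A B : Set} (P : Processor A B) where
  open Processor P

  IsAbelian : Set
  IsAbelian =
    (∀ i j q → trans i (trans j q) ≡ trans j (trans i q)) ×
    (∀ i j q b → out i q b + out j (trans i q) b ≡ out j q b + out i (trans j q) b)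

  runState : List A → Fin size → Fin size
  runState []      q = q
  runState (a ∷ w) q = runState w (trans a q)

  outWord : List A → Fin size → B → ℕ
  outWord []      q b = 0
  outWord (a ∷ w) q b = out a q b + outWord w (trans a q) b

  AllReachable : Set
  AllReachable = ∀ q → ∃ λ (w : List A) → runState w init ≡ q

canonWord : ∀ {m} → (Fin m → ℕ) → List (Fin m)
canonWord {m} x = concatMap (λ i → replicate (x i) i) (allFinL m)

-- the function N^A → N^B computed by a processor with A = Fin m
-- (for abelian processors the order of the input letters is irrelevant)
procFun : ∀ {m k} → Processor (Fin m) (Fin k) → (Fin m → ℕ) → Fin k → ℕ
procFun P x = outWord P (canonWord x) (Processor.init P)

-- Networks: finite directed multigraph on nodes Fin nodes, with
-- input edges (head only), internal edges (tail and head),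
-- output edges and trash edges (tail only).

record Graph : Set where
  field
    nodes nIn nInt nOut nTrash : ℕ
    inHead    : Fin nIn → Fin nodes
    intTail   : Fin nInt → Fin nodes
    intHead   : Fin nInt → Fin nodes
    outTail   : Fin nOut → Fin nodes
    trashTail : Fin nTrash → Fin nodes

module _ (G : Graph) where
  open Graph G

  HeadEdge : Set
  HeadEdge = Fin nIn ⊎ Fin nInt

  TailEdge : Set
  TailEdge = Fin nInt ⊎ (Fin nOut ⊎ Fin nTrash)

  head : HeadEdge → Fin nodes
  head (inj₁ i) = inHead i
  head (inj₂ e) = intHead e

  tail : TailEdge → Fin nodes
  tail (inj₁ e)        = intTail e
  tail (inj₂ (inj₁ o)) = outTail o
  tail (inj₂ (inj₂ t)) = trashTail t

  InEdges : Fin nodes → Set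
  InEdges v = Σ HeadEdge λ e → head e ≡ v

  OutEdges : Fin nodes → Set
  OutEdges v = Σ TailEdge λ e → tail e ≡ v

record Network (G : Graph) : Set where
  field
    proc      : (v : Fin (Graph.nodes G)) → Processor (InEdges G v) (OutEdges G v)
    abelian   : ∀ v → IsAbelian (proc v)
    reachable : ∀ v → AllReachable (proc v)

module _ {G : Graph} (N : Network G) where
  open Graph G
  open Network N

  record Config : Set where
    constructor config
    field
      states  : (v : Fin nodes) → Fin (Processor.size (proc v))
      pending : HeadEdge G → ℕ
      outputs : Fin nOut → ℕ
      trashed : Fin nTrash → ℕ
  open Config public

  updState : (σ : (v : Fin nodes) → Fin (Processor.size (proc v)))
             (v : Fin nodes) → Fin (Processor.size (proc v)) →
             (w : Fin nodes) → Fin (Processor.size (proc w))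
  updState σ v q w with v ≟ w
  ... | yes refl = q
  ... | no _     = σ w

  emitted : (v : Fin nodes) → Fin (Processor.size (proc v)) → InEdges G v → TailEdge G → ℕ
  emitted v s a f with tail G f ≟ v
  ... | yes p = Processor.out (proc v) a s (f , p)
  ... | no _  = 0

  fire : Config → HeadEdge G → Config
  fire c e = config
      (updState (states c) v (Processor.trans (proc v) a s))
      (λ e' → dec e' + gain e')
      (λ o → outputs c o + emitted v s a (inj₂ (inj₁ o)))
      (λ t → trashed c t + emitted v s a (inj₂ (inj₂ t)))
    where
      v = head G e
      a : InEdges G v
      a = e , refl
      s = states c v
      dec : HeadEdge G → ℕ
      dec e' with ≡-dec _≟_ _≟_ e' e
      ... | yes _ = pending c e' ∸ 1
      ... | no _  = pending c e'
      gain : HeadEdge G → ℕ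
      gain (inj₁ _) = 0
      gain (inj₂ i) = emitted v s a (inj₁ i)

  data Reaches : Config → Config → Set where
    done : ∀ {c} → Reaches c c
    step : ∀ {c d} (e : HeadEdge G) → 0 < pending c e → Reaches (fire c e) d → Reaches c d

  Halted : Config → Set
  Halted c = ∀ e → pending c e ≡ 0

  initConfig : (Fin nIn → ℕ) → Config
  initConfig x = config (λ v → Processor.init (proc v)) p (λ _ → 0) (λ _ → 0)
    where
      p : HeadEdge G → ℕ
      p (inj₁ i) = x i
      p (inj₂ _) = 0

  -- the network halts on every input vector (some run halts; by the known
  -- fact this is equivalent to every run halting)
  HaltsOnAllInputs : Set
  HaltsOnAllInputs = ∀ x → Σ Config λ c → Reaches (initConfig x) c × Halted c

  Emulates : Processor (Fin nIn) (Fin nOut) → Set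
  Emulates P = ∀ x c → Reaches (initConfig x) c → Halted c →
               ∀ o → outputs c o ≡ procFun P x o

-- The processor is obtained by a Myhill–Nerode construction.  Feed the network
-- an input word w (i.e. the input vector of its letter counts) and let it
-- settle; record the tuple of node states (its "code", an element of a finite
-- set Fin M) and the letters on the output edges (F w).  Confluence of the
-- network makes these well defined and shows: the code after w determines the
-- code after w followed by a letter a, and the number of letters output in
-- between; and both data only depend on the letter counts of w.  The codes
-- reachable by words - all already reached by words of length ≤ M, by the
-- pigeonhole principle - are then the states of an abelian processor, all
-- reachable, computing F, hence the function of the network.

module Submission where

open import Defs
open import Data.Fin using (Fin)
open import Data.Product using (Σ; _×_)

open import Data.Bool using (if_then_else_)
open import Data.Empty using (⊥-elim)
open import Data.Fin using (zero; suc; toℕ; combine; _≟_)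
open import Data.Fin.Properties using (pigeonhole; toℕ≤pred[n]; combine-injective)
open import Data.List using (List; []; _∷_; _++_; _∷ʳ_; length; take; drop; map; replicate; concatMap;
  allFin; lookup; cartesianProductWith; deduplicate; tabulate)
open import Data.List.Properties using (++-identityʳ; ∷ʳ-++; length-++; length-take; length-drop; take++drop≡id)
open import Data.List.Membership.Propositional using (_∈_)
open import Data.List.Membership.Propositional.Properties
  using (∈-map⁺; ∈-map⁻; ∈-allFin; ∈-lookup; ∈-cartesianProductWith⁺; ∈-deduplicate⁺; ∈-deduplicate⁻)
import Data.List.Relation.Unary.All as All
open import Data.List.Relation.Unary.AllPairs using (_∷_)
open import Data.List.Relation.Unary.Any using (here; there; index)
open import Data.List.Relation.Unary.Any.Properties using (lookup-index)
open import Data.List.Relation.Unary.Unique.Propositional using (Unique)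
open import Data.List.Relation.Unary.Unique.DecPropositional.Properties using (deduplicate-!)
open import Data.Nat using (ℕ; zero; suc; _+_; _*_; _∸_; _≤_; _<_; z≤n; s≤s; _≤?_)
open import Data.Nat.Properties
  using (+-comm; +-assoc; +-identityʳ; +-commutativeSemigroup; *-suc; *-zeroʳ; *-distribʳ-+;
         +-cancelˡ-≡; +-cancelʳ-≡; ≤-refl; ≤-trans; <⇒≤; <⇒≢; ≤-pred; ≰⇒>; n<1+n; m≤m+n;
         +-monoˡ-<; m+[n∸m]≡n; m+n∸m≡n; m∸n+n≡m; m≤n⇒m⊓n≡m; module ≤-Reasoning)
open import Data.Product using (∃; _,_; proj₁; proj₂)
open import Data.Sum using (inj₁; inj₂)
open import Data.Sum.Properties using (≡-dec)
open import Function using (_∘_)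
open import Relation.Nullary using (Dec; does; yes; no)
open import Relation.Binary.PropositionalEquality
  using (_≡_; _≢_; refl; sym; trans; cong; cong₂; subst; subst₂; module ≡-Reasoning)
open import Algebra.Properties.CommutativeSemigroup +-commutativeSemigroup using (xy∙z≈xz∙y)

-- The indicator of a decidable proposition.  It is defined through 'does',
-- so that it computes through 'Dec.map′' (e.g. 𝟙 (suc i ≟ suc j) = 𝟙 (i ≟ j)).
𝟙 : {P : Set} → Dec P → ℕ
𝟙 d = if does d then 1 else 0

private
  variable
    k : ℕ

-- The number of occurrences of the letter i in a word: the input vector a
-- word represents.
occ : List (Fin k) → Fin k → ℕ
occ []      i = 0
occ (b ∷ w) i = 𝟙 (i ≟ b) + occ w i

occ-++ : ∀ (u v : List (Fin k)) i → occ (u ++ v) i ≡ occ u i + occ v i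
occ-++ []      v i = refl
occ-++ (b ∷ u) v i = trans (cong (𝟙 (i ≟ b) +_) (occ-++ u v i)) (sym (+-assoc (𝟙 (i ≟ b)) _ _))

occ-∷ʳ : ∀ (w : List (Fin k)) a i → occ (w ∷ʳ a) i ≡ occ w i + 𝟙 (i ≟ a)
occ-∷ʳ w a i = trans (occ-++ w (a ∷ []) i) (cong (occ w i +_) (+-identityʳ _))

occ-swap : ∀ (w : List (Fin k)) a a' i → occ (w ∷ʳ a ∷ʳ a') i ≡ occ (w ∷ʳ a' ∷ʳ a) i
occ-swap w a a' i = begin
    occ (w ∷ʳ a ∷ʳ a') i              ≡⟨ trans (occ-∷ʳ (w ∷ʳ a) a' i) (cong (_+ 𝟙 (i ≟ a')) (occ-∷ʳ w a i)) ⟩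
    occ w i + 𝟙 (i ≟ a) + 𝟙 (i ≟ a')  ≡⟨ xy∙z≈xz∙y (occ w i) (𝟙 (i ≟ a)) (𝟙 (i ≟ a')) ⟩
    occ w i + 𝟙 (i ≟ a') + 𝟙 (i ≟ a)  ≡⟨ sym (trans (occ-∷ʳ (w ∷ʳ a') a i) (cong (_+ 𝟙 (i ≟ a)) (occ-∷ʳ w a' i))) ⟩
    occ (w ∷ʳ a' ∷ʳ a) i              ∎
  where open ≡-Reasoning

occ-replicate : ∀ n (b i : Fin k) → occ (replicate n b) i ≡ 𝟙 (i ≟ b) * n
occ-replicate zero    b i = sym (*-zeroʳ (𝟙 (i ≟ b)))
occ-replicate (suc n) b i = trans (cong (𝟙 (i ≟ b) +_) (occ-replicate n b i)) (sym (*-suc (𝟙 (i ≟ b)) n))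

𝟙-block : ∀ (x : Fin k → ℕ) i b → 𝟙 (i ≟ b) * x b ≡ 𝟙 (i ≟ b) * x i
𝟙-block x i b with i ≟ b
... | yes refl = refl
... | no _     = refl

occ-blocks : ∀ (x : Fin k → ℕ) L i →
             occ (concatMap (λ j → replicate (x j) j) L) i ≡ occ L i * x i
occ-blocks x []      i = refl
occ-blocks x (b ∷ L) i = begin
    occ (replicate (x b) b ++ rest) i   ≡⟨ occ-++ (replicate (x b) b) rest i ⟩
    occ (replicate (x b) b) i + occ rest i
      ≡⟨ cong₂ _+_ (trans (occ-replicate (x b) b i) (𝟙-block x i b)) (occ-blocks x L i) ⟩
    𝟙 (i ≟ b) * x i + occ L i * x i     ≡⟨ sym (*-distribʳ-+ (x i) (𝟙 (i ≟ b)) (occ L i)) ⟩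
    (𝟙 (i ≟ b) + occ L i) * x i         ∎
  where
    open ≡-Reasoning
    rest = concatMap (λ j → replicate (x j) j) L

occ-tabulate-suc : ∀ {n} (f : Fin n → Fin k) i → occ (tabulate (λ j → suc (f j))) (suc i) ≡ occ (tabulate f) i
occ-tabulate-suc {n = zero}  f i = refl
occ-tabulate-suc {n = suc n} f i = cong (𝟙 (i ≟ f zero) +_) (occ-tabulate-suc (λ j → f (suc j)) i)

occ-tabulate-zero : ∀ {n} (f : Fin n → Fin k) → occ (tabulate (λ j → suc (f j))) zero ≡ 0
occ-tabulate-zero {n = zero}  f = refl
occ-tabulate-zero {n = suc n} f = occ-tabulate-zero (λ j → f (suc j))

occ-allFin : ∀ (i : Fin k) → occ (allFin k) i ≡ 1
occ-allFin {suc k} zero    = cong suc (occ-tabulate-zero {k = k} (λ j → j))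
occ-allFin {suc k} (suc i) = trans (occ-tabulate-suc (λ j → j) i) (occ-allFin i)

occ-canonWord : ∀ (x : Fin k → ℕ) i → occ (canonWord x) i ≡ x i
occ-canonWord {k} x i = trans (occ-blocks x (allFin k) i) (trans (cong (_* x i) (occ-allFin i)) (+-identityʳ (x i)))

-- Tuples (v : Fin n) → Fin (s v) are encoded injectively in the finite set
-- Fin (∏ s); this makes tuples of node states amenable to the pigeonhole principle.
∏ : ∀ n → (Fin n → ℕ) → ℕ
∏ zero    s = 1
∏ (suc n) s = s zero * ∏ n (λ v → s (suc v))

encode : ∀ {n} {s : Fin n → ℕ} → ((v : Fin n) → Fin (s v)) → Fin (∏ n s)
encode {zero}  σ = zero
encode {suc n} σ = combine (σ zero) (encode (λ v → σ (suc v)))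

encode-cong : ∀ {n} {s : Fin n → ℕ} {σ σ' : (v : Fin n) → Fin (s v)} →
              (∀ v → σ v ≡ σ' v) → encode σ ≡ encode σ'
encode-cong {zero}  eq = refl
encode-cong {suc n} eq = cong₂ combine (eq zero) (encode-cong (λ v → eq (suc v)))

encode-injective : ∀ {n} {s : Fin n → ℕ} (σ σ' : (v : Fin n) → Fin (s v)) →
                   encode σ ≡ encode σ' → ∀ v → σ v ≡ σ' v
encode-injective {suc n} σ σ' eq zero    = proj₁ (combine-injective _ _ _ _ eq)
encode-injective {suc n} σ σ' eq (suc v) =
  encode-injective (λ u → σ (suc u)) (λ u → σ' (suc u)) (proj₂ (combine-injective (σ zero) _ (σ' zero) _ eq)) v

lookup-injective : ∀ {A : Set} {xs : List A} → Unique xs → ∀ i j → lookup xs i ≡ lookup xs j → i ≡ j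
lookup-injective (x∉xs ∷ u) zero    zero    eq = refl
lookup-injective (x∉xs ∷ u) zero    (suc j) eq = ⊥-elim (All.lookup x∉xs (∈-lookup j) eq)
lookup-injective (x∉xs ∷ u) (suc i) zero    eq = ⊥-elim (All.lookup x∉xs (∈-lookup i) (sym eq))
lookup-injective (x∉xs ∷ u) (suc i) (suc j) eq = cong suc (lookup-injective u i j eq)

-- If equal codes stay equal after appending a letter
-- and have equal increments, the codes of words are the states of a processor,
-- all reachable, with output F w on input w; it is abelian if codes and outputs
-- are insensitive to the order of the last two letters.
module QuotientProcessor
  {k m M : ℕ}
  (code : List (Fin k) → Fin M)
  (F    : List (Fin k) → Fin m → ℕ)
  (Δ    : List (Fin k) → Fin k → Fin m → ℕ)
  (code-step : ∀ w w' a → code w ≡ code w' → code (w ∷ʳ a) ≡ code (w' ∷ʳ a))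
  (Δ-resp    : ∀ w w' a b → code w ≡ code w' → Δ w a b ≡ Δ w' a b)
  (F-step    : ∀ w a b → F (w ∷ʳ a) b ≡ F w b + Δ w a b)
  (F-nil     : ∀ b → F [] b ≡ 0)
  (code-swap : ∀ w a a' → code (w ∷ʳ a ∷ʳ a') ≡ code (w ∷ʳ a' ∷ʳ a))
  (F-swap    : ∀ w a a' b → F (w ∷ʳ a ∷ʳ a') b ≡ F (w ∷ʳ a' ∷ʳ a) b)
  where

  Word : Set
  Word = List (Fin k)

  code-append : ∀ {w w'} u → code w ≡ code w' → code (w ++ u) ≡ code (w' ++ u)
  code-append {w} {w'} []      eq = subst₂ (λ x y → code x ≡ code y) (sym (++-identityʳ w)) (sym (++-identityʳ w')) eq
  code-append {w} {w'} (a ∷ u) eq =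
    subst₂ (λ x y → code x ≡ code y) (∷ʳ-++ w a u) (∷ʳ-++ w' a u) (code-append u (code-step w w' a eq))

  -- A word longer than M has a strictly shorter word with the same code: two of
  -- its prefixes of lengths 0, …, M have the same code, so the part between them
  -- can be cut out.
  shorten : ∀ w → M < length w → ∃ λ w' → length w' < length w × code w' ≡ code w
  shorten w M<L with pigeonhole (n<1+n M) (λ i → code (take (toℕ i) w))
  ... | i , j , i<j , same = take (toℕ i) w ++ drop (toℕ j) w , shorter , same-code
    where
      L = length w
      j≤L : toℕ j ≤ L
      j≤L = ≤-trans (toℕ≤pred[n] j) (<⇒≤ M<L)
      shorter : length (take (toℕ i) w ++ drop (toℕ j) w) < L
      shorter = begin-strict
        length (take (toℕ i) w ++ drop (toℕ j) w)  ≡⟨ length-++ (take (toℕ i) w) ⟩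
        length (take (toℕ i) w) + length (drop (toℕ j) w)
          ≡⟨ cong₂ _+_ (trans (length-take (toℕ i) w) (m≤n⇒m⊓n≡m (≤-trans (<⇒≤ i<j) j≤L)))
                       (length-drop (toℕ j) w) ⟩
        toℕ i + (L ∸ toℕ j)                       <⟨ +-monoˡ-< (L ∸ toℕ j) i<j ⟩
        toℕ j + (L ∸ toℕ j)                       ≡⟨ m+[n∸m]≡n j≤L ⟩
        L                                         ∎
        where open ≤-Reasoning
      same-code : code (take (toℕ i) w ++ drop (toℕ j) w) ≡ code w
      same-code = trans (code-append (drop (toℕ j) w) same) (cong code (take++drop≡id (toℕ j) w))

  short : ∀ w → ∃ λ w' → length w' ≤ M × code w' ≡ code w
  short w = shortWithin (length w) w ≤-refl
    where
      shortWithin : ∀ n w → length w ≤ n → ∃ λ w' → length w' ≤ M × code w' ≡ code w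
      shortWithin n w ℓ≤n with length w ≤? M
      ... | yes ℓ≤M = w , ℓ≤M , refl
      shortWithin zero w ℓ≤0 | no ℓ≰M = ⊥-elim (ℓ≰M (≤-trans ℓ≤0 z≤n))
      shortWithin (suc n) w ℓ≤1+n | no ℓ≰M with shorten w (≰⇒> ℓ≰M)
      ... | w₁ , shorter , eq₁ with shortWithin n w₁ (≤-pred (≤-trans shorter ℓ≤1+n))
      ...   | w₂ , ℓ₂≤M , eq₂ = w₂ , ℓ₂≤M , trans eq₂ eq₁

  wordsUpTo : ℕ → List Word
  wordsUpTo zero    = [] ∷ []
  wordsUpTo (suc n) = [] ∷ cartesianProductWith _∷_ (allFin k) (wordsUpTo n)

  ∈-wordsUpTo : ∀ {n} w → length w ≤ n → w ∈ wordsUpTo n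
  ∈-wordsUpTo {zero}  []      _         = here refl
  ∈-wordsUpTo {suc n} []      _         = here refl
  ∈-wordsUpTo {suc n} (a ∷ w) (s≤s ℓ≤n) = there (∈-cartesianProductWith⁺ _∷_ (∈-allFin a) (∈-wordsUpTo w ℓ≤n))

  -- the codes of the words of length ≤ M - by 'short', these are all codes of
  -- words - without repetitions; their positions are the states
  codes : List (Fin M)
  codes = deduplicate _≟_ (map code (wordsUpTo M))

  codes-unique : Unique codes
  codes-unique = deduplicate-! _≟_ (map code (wordsUpTo M))

  State : Set
  State = Fin (length codes)

  -- The state of a word and a representative word of a state.  Only the
  -- stated properties of these are used, so they are kept opaque.
  opaque
    code∈codes : ∀ w → code w ∈ codes
    code∈codes w with short w
    ... | w' , ℓ≤M , eq rewrite sym eq = ∈-deduplicate⁺ _≟_ (∈-map⁺ code (∈-wordsUpTo w' ℓ≤M))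

    ⟦_⟧ : Word → State
    ⟦ w ⟧ = index (code∈codes w)

    code-⟦⟧ : ∀ w → lookup codes ⟦ w ⟧ ≡ code w
    code-⟦⟧ w = sym (lookup-index (code∈codes w))

    represented : ∀ q → ∃ λ w → w ∈ wordsUpTo M × lookup codes q ≡ code w
    represented q = ∈-map⁻ code (∈-deduplicate⁻ _≟_ (map code (wordsUpTo M)) (∈-lookup q))

    rep : State → Word
    rep q = proj₁ (represented q)

    code-rep : ∀ q → code (rep q) ≡ lookup codes q
    code-rep q = sym (proj₂ (proj₂ (represented q)))

  ⟦⟧-resp : ∀ {w w'} → code w ≡ code w' → ⟦ w ⟧ ≡ ⟦ w' ⟧
  ⟦⟧-resp {w} {w'} eq = lookup-injective codes-unique _ _ (trans (code-⟦⟧ w) (trans eq (sym (code-⟦⟧ w'))))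

  ⟦rep⟧ : ∀ q → ⟦ rep q ⟧ ≡ q
  ⟦rep⟧ q = lookup-injective codes-unique _ _ (trans (code-⟦⟧ (rep q)) (code-rep q))

  processor : Processor (Fin k) (Fin m)
  processor = record
    { size  = length codes
    ; trans = λ a q → ⟦ rep q ∷ʳ a ⟧
    ; out   = λ a q b → Δ (rep q) a b
    ; init  = ⟦ [] ⟧
    }

  open Processor processor using () renaming (trans to next; out to emit)

  code-rep⟦⟧ : ∀ w → code (rep ⟦ w ⟧) ≡ code w
  code-rep⟦⟧ w = trans (code-rep ⟦ w ⟧) (code-⟦⟧ w)

  next-⟦⟧ : ∀ a w → next a ⟦ w ⟧ ≡ ⟦ w ∷ʳ a ⟧
  next-⟦⟧ a w = ⟦⟧-resp (code-step (rep ⟦ w ⟧) w a (code-rep⟦⟧ w))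

  emit-⟦⟧ : ∀ a w b → emit a ⟦ w ⟧ b ≡ Δ w a b
  emit-⟦⟧ a w b = Δ-resp (rep ⟦ w ⟧) w a b (code-rep⟦⟧ w)

  runState-⟦⟧ : ∀ u w → runState processor u ⟦ w ⟧ ≡ ⟦ w ++ u ⟧
  runState-⟦⟧ []      w = cong ⟦_⟧ (sym (++-identityʳ w))
  runState-⟦⟧ (a ∷ u) w = begin
      runState processor u (next a ⟦ w ⟧)  ≡⟨ cong (runState processor u) (next-⟦⟧ a w) ⟩
      runState processor u ⟦ w ∷ʳ a ⟧      ≡⟨ runState-⟦⟧ u (w ∷ʳ a) ⟩
      ⟦ w ∷ʳ a ++ u ⟧                      ≡⟨ cong ⟦_⟧ (∷ʳ-++ w a u) ⟩
      ⟦ w ++ a ∷ u ⟧                       ∎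
    where open ≡-Reasoning

  outWord-⟦⟧ : ∀ u w b → F w b + outWord processor u ⟦ w ⟧ b ≡ F (w ++ u) b
  outWord-⟦⟧ []      w b = trans (+-identityʳ (F w b)) (cong (λ v → F v b) (sym (++-identityʳ w)))
  outWord-⟦⟧ (a ∷ u) w b = begin
      F w b + (emit a ⟦ w ⟧ b + outWord processor u (next a ⟦ w ⟧) b)
        ≡⟨ cong₂ (λ x q → F w b + (x + outWord processor u q b)) (emit-⟦⟧ a w b) (next-⟦⟧ a w) ⟩
      F w b + (Δ w a b + outWord processor u ⟦ w ∷ʳ a ⟧ b)
        ≡⟨ sym (+-assoc (F w b) _ _) ⟩
      (F w b + Δ w a b) + outWord processor u ⟦ w ∷ʳ a ⟧ b
        ≡⟨ cong (_+ outWord processor u ⟦ w ∷ʳ a ⟧ b) (sym (F-step w a b)) ⟩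
      F (w ∷ʳ a) b + outWord processor u ⟦ w ∷ʳ a ⟧ b
        ≡⟨ outWord-⟦⟧ u (w ∷ʳ a) b ⟩
      F (w ∷ʳ a ++ u) b
        ≡⟨ cong (λ v → F v b) (∷ʳ-++ w a u) ⟩
      F (w ++ a ∷ u) b ∎
    where open ≡-Reasoning

  computes : ∀ w b → outWord processor w (Processor.init processor) b ≡ F w b
  computes w b = trans (cong (_+ outWord processor w ⟦ [] ⟧ b) (sym (F-nil b))) (outWord-⟦⟧ w [] b)

  reachable : AllReachable processor
  reachable q = rep q , trans (runState-⟦⟧ (rep q) []) (⟦rep⟧ q)

  emit-twice : ∀ w a a' b → F w b + (emit a ⟦ w ⟧ b + emit a' (next a ⟦ w ⟧) b) ≡ F (w ∷ʳ a ∷ʳ a') b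
  emit-twice w a a' b = begin
      F w b + (emit a ⟦ w ⟧ b + emit a' (next a ⟦ w ⟧) b)
        ≡⟨ cong₂ (λ x y → F w b + (x + y)) (emit-⟦⟧ a w b)
                 (trans (cong (λ q → emit a' q b) (next-⟦⟧ a w)) (emit-⟦⟧ a' (w ∷ʳ a) b)) ⟩
      F w b + (Δ w a b + Δ (w ∷ʳ a) a' b)   ≡⟨ sym (+-assoc (F w b) _ _) ⟩
      (F w b + Δ w a b) + Δ (w ∷ʳ a) a' b   ≡⟨ cong (_+ Δ (w ∷ʳ a) a' b) (sym (F-step w a b)) ⟩
      F (w ∷ʳ a) b + Δ (w ∷ʳ a) a' b        ≡⟨ sym (F-step (w ∷ʳ a) a' b) ⟩
      F (w ∷ʳ a ∷ʳ a') b                    ∎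
    where open ≡-Reasoning

  state-induction : (P : State → Set) → (∀ w → P ⟦ w ⟧) → ∀ q → P q
  state-induction P P⟦⟧ q = subst P (⟦rep⟧ q) (P⟦⟧ (rep q))

  next-comm : ∀ a a' w → next a (next a' ⟦ w ⟧) ≡ next a' (next a ⟦ w ⟧)
  next-comm a a' w = begin
      next a (next a' ⟦ w ⟧)   ≡⟨ trans (cong (next a) (next-⟦⟧ a' w)) (next-⟦⟧ a (w ∷ʳ a')) ⟩
      ⟦ w ∷ʳ a' ∷ʳ a ⟧         ≡⟨ ⟦⟧-resp (code-swap w a' a) ⟩
      ⟦ w ∷ʳ a ∷ʳ a' ⟧         ≡⟨ sym (trans (cong (next a') (next-⟦⟧ a w)) (next-⟦⟧ a' (w ∷ʳ a))) ⟩
      next a' (next a ⟦ w ⟧)   ∎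
    where open ≡-Reasoning

  emit-comm : ∀ a a' w b → emit a ⟦ w ⟧ b + emit a' (next a ⟦ w ⟧) b ≡ emit a' ⟦ w ⟧ b + emit a (next a' ⟦ w ⟧) b
  emit-comm a a' w b = +-cancelˡ-≡ (F w b) _ _
    (trans (emit-twice w a a' b) (trans (F-swap w a a' b) (sym (emit-twice w a' a b))))

  abelian : IsAbelian processor
  abelian =
    (λ a a' → state-induction (λ q → next a (next a' q) ≡ next a' (next a q)) (next-comm a a')) ,
    (λ a a' q b → state-induction (λ q → emit a q b + emit a' (next a q) b ≡ emit a' q b + emit a (next a' q) b)
                                  (λ w → emit-comm a a' w b) q)

-- Confluence of an abelian network: firing enabled edges in any order leads to
-- the same halting configuration, and runs only depend on states and pending
-- letters.
module Confluence {G : Graph} (N : Network G) where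
  open Graph G
  open Network N

  NodeStates : Set
  NodeStates = (v : Fin nodes) → Fin (Processor.size (proc v))

  advance : NodeStates → (v : Fin nodes) → InEdges G v → NodeStates
  advance σ v a = updState N σ v (Processor.trans (proc v) a (σ v))

  advance-at : ∀ σ v a → advance σ v a v ≡ Processor.trans (proc v) a (σ v)
  advance-at σ v a with v ≟ v
  ... | yes refl = refl
  ... | no v≢v   = ⊥-elim (v≢v refl)

  advance-away : ∀ σ v a w → v ≢ w → advance σ v a w ≡ σ w
  advance-away σ v a w v≢w with v ≟ w
  ... | yes v≡w = ⊥-elim (v≢w v≡w)
  ... | no _    = refl

  advance-cong : ∀ {σ σ'} v a → (∀ u → σ u ≡ σ' u) → ∀ w → advance σ v a w ≡ advance σ' v a w
  advance-cong v a eq w with v ≟ w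
  ... | yes refl = cong (Processor.trans (proc v) a) (eq v)
  ... | no _     = eq w

  advance-comm : ∀ σ v v' (a : InEdges G v) (a' : InEdges G v') w →
                 advance (advance σ v a) v' a' w ≡ advance (advance σ v' a') v a w
  advance-comm σ v v' a a' w with v ≟ w | v' ≟ w
  ... | yes refl | yes refl = begin
      T a' (advance σ v a v)  ≡⟨ cong (T a') (advance-at σ v a) ⟩
      T a' (T a (σ v))        ≡⟨ proj₁ (abelian v) a' a (σ v) ⟩
      T a (T a' (σ v))        ≡⟨ cong (T a) (sym (advance-at σ v a')) ⟩
      T a (advance σ v a' v)  ∎
    where
      open ≡-Reasoning
      T = Processor.trans (proc v)
  ... | yes refl | no v'≢v  =
    trans (advance-at σ v a) (cong (Processor.trans (proc v) a) (sym (advance-away σ v' a' v v'≢v)))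
  ... | no v≢v'  | yes refl =
    trans (cong (Processor.trans (proc v') a') (advance-away σ v a v' v≢v')) (sym (advance-at σ v' a'))
  ... | no v≢w   | no v'≢w  = trans (advance-away σ v a w v≢w) (sym (advance-away σ v' a' w v'≢w))

  emitted-abelian : ∀ v s (a a' : InEdges G v) f →
    emitted N v s a f + emitted N v (Processor.trans (proc v) a s) a' f
      ≡ emitted N v s a' f + emitted N v (Processor.trans (proc v) a' s) a f
  emitted-abelian v s a a' f with tail G f ≟ v
  ... | yes f-at-v = proj₂ (abelian v) a a' s (f , f-at-v)
  ... | no _       = refl

  emitted-comm : ∀ σ v v' (a : InEdges G v) (a' : InEdges G v') f →
    emitted N v (σ v) a f + emitted N v' (advance σ v a v') a' f
      ≡ emitted N v' (σ v') a' f + emitted N v (advance σ v' a' v) a f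
  emitted-comm σ v v' a a' f with v ≟ v'
  ... | yes refl rewrite advance-at σ v a' = emitted-abelian v (σ v) a a' f
  ... | no v≢v'  rewrite advance-away σ v' a' v (v≢v' ∘ sym) =
    +-comm (emitted N v (σ v) a f) (emitted N v' (σ v') a' f)

  gain : NodeStates → HeadEdge G → HeadEdge G → ℕ
  gain σ e (inj₁ _) = 0
  gain σ e (inj₂ i) = emitted N (head G e) (σ (head G e)) (e , refl) (inj₁ i)

  gain-comm : ∀ σ e e' e'' →
    gain σ e e'' + gain (advance σ (head G e) (e , refl)) e' e''
      ≡ gain σ e' e'' + gain (advance σ (head G e') (e' , refl)) e e''
  gain-comm σ e e' (inj₁ _) = refl
  gain-comm σ e e' (inj₂ i) = emitted-comm σ (head G e) (head G e') (e , refl) (e' , refl) (inj₁ i)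

  δ : HeadEdge G → HeadEdge G → ℕ
  δ e' e = 𝟙 (≡-dec _≟_ _≟_ e' e)

  δ-≢ : ∀ {e' e} → e' ≢ e → δ e' e ≡ 0
  δ-≢ {e'} {e} e'≢e with ≡-dec _≟_ _≟_ e' e
  ... | yes e'≡e = ⊥-elim (e'≢e e'≡e)
  ... | no _     = refl

  δ-≤ : ∀ (c : Config N) e e' → 0 < pending c e → δ e' e ≤ pending c e'
  δ-≤ c e e' enabled with ≡-dec _≟_ _≟_ e' e
  ... | yes refl = enabled
  ... | no _     = z≤n

  pending-fire : ∀ c e e' → pending (fire N c e) e' ≡ (pending c e' ∸ δ e' e) + gain (states c) e e'
  pending-fire c e e' with ≡-dec _≟_ _≟_ e' e
  pending-fire c e (inj₁ _) | yes _ = refl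
  pending-fire c e (inj₂ _) | yes _ = refl
  pending-fire c e (inj₁ _) | no _  = refl
  pending-fire c e (inj₂ _) | no _  = refl

  pending-fire-enabled : ∀ c e e' → 0 < pending c e →
    pending (fire N c e) e' + δ e' e ≡ pending c e' + gain (states c) e e'
  pending-fire-enabled c e e' enabled = begin
      pending (fire N c e) e' + δ e' e        ≡⟨ cong (_+ δ e' e) (pending-fire c e e') ⟩
      (pending c e' ∸ δ e' e) + g + δ e' e    ≡⟨ xy∙z≈xz∙y (pending c e' ∸ δ e' e) g (δ e' e) ⟩
      (pending c e' ∸ δ e' e) + δ e' e + g    ≡⟨ cong (_+ g) (m∸n+n≡m (δ-≤ c e e' enabled)) ⟩
      pending c e' + g                        ∎
    where
      open ≡-Reasoning
      g = gain (states c) e e'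

  fire-keeps : ∀ c {e e'} → e' ≢ e → pending c e' ≤ pending (fire N c e) e'
  fire-keeps c {e} {e'} e'≢e = begin
      pending c e'                                   ≤⟨ m≤m+n (pending c e') (gain (states c) e e') ⟩
      pending c e' + gain (states c) e e'            ≡⟨ cong (λ d → (pending c e' ∸ d) + gain (states c) e e') (sym (δ-≢ e'≢e)) ⟩
      (pending c e' ∸ δ e' e) + gain (states c) e e' ≡⟨ sym (pending-fire c e e') ⟩
      pending (fire N c e) e'                        ∎
    where open ≤-Reasoning

  infix 4 _∼_ _≈_
  infixl 6 _⊕_

  record _∼_ (c d : Config N) : Set where
    field
      same-states  : ∀ v → states c v ≡ states d v
      same-pending : ∀ e → pending c e ≡ pending d e
  open _∼_ public

  record _≈_ (c d : Config N) : Set where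
    field
      core         : c ∼ d
      same-outputs : ∀ o → outputs c o ≡ outputs d o
  open _≈_ public

  ≈-refl : ∀ {c} → c ≈ c
  ≈-refl = record { core = record { same-states = λ _ → refl ; same-pending = λ _ → refl } ; same-outputs = λ _ → refl }

  ≈-sym : ∀ {c d} → c ≈ d → d ≈ c
  ≈-sym c≈d = record
    { core = record { same-states = sym ∘ same-states (core c≈d) ; same-pending = sym ∘ same-pending (core c≈d) }
    ; same-outputs = sym ∘ same-outputs c≈d }

  ≈-trans : ∀ {c d f} → c ≈ d → d ≈ f → c ≈ f
  ≈-trans c≈d d≈f = record
    { core = record
      { same-states  = λ v → trans (same-states (core c≈d) v) (same-states (core d≈f) v)
      ; same-pending = λ e → trans (same-pending (core c≈d) e) (same-pending (core d≈f) e) }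
    ; same-outputs = λ o → trans (same-outputs c≈d o) (same-outputs d≈f o) }

  halted-∼ : ∀ {c d} → c ∼ d → Halted N c → Halted N d
  halted-∼ c∼d halted e = trans (sym (same-pending c∼d e)) (halted e)

  gain-cong : ∀ {σ σ'} e e' → σ (head G e) ≡ σ' (head G e) → gain σ e e' ≡ gain σ' e e'
  gain-cong e (inj₁ _) eq = refl
  gain-cong e (inj₂ i) eq = cong (λ s → emitted N (head G e) s (e , refl) (inj₁ i)) eq

  fire-∼ : ∀ {c c'} e → c ∼ c' → fire N c e ∼ fire N c' e
  fire-∼ {c} {c'} e c∼c' = record
    { same-states  = advance-cong (head G e) (e , refl) (same-states c∼c')
    ; same-pending = λ e' → begin
        pending (fire N c e) e'                            ≡⟨ pending-fire c e e' ⟩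
        (pending c e' ∸ δ e' e) + gain (states c) e e'
          ≡⟨ cong₂ (λ p g → (p ∸ δ e' e) + g) (same-pending c∼c' e')
                   (gain-cong e e' (same-states c∼c' (head G e))) ⟩
        (pending c' e' ∸ δ e' e) + gain (states c') e e'   ≡⟨ sym (pending-fire c' e e') ⟩
        pending (fire N c' e) e'                           ∎ }
    where open ≡-Reasoning

  OutputGain : Config N → (Fin nOut → ℕ) → Config N → Set
  OutputGain c g d = ∀ o → outputs d o ≡ outputs c o + g o

  record Replay (c c' d : Config N) : Set where
    field
      end          : Config N
      run          : Reaches N c' end
      end-∼        : d ∼ end
      produced     : Fin nOut → ℕ
      produced-d   : OutputGain c produced d
      produced-end : OutputGain c' produced end

  replay : ∀ {c c' d} → c ∼ c' → Reaches N c d → Replay c c' d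
  replay {c} {c'} c∼c' done = record
    { end = c' ; run = done ; end-∼ = c∼c' ; produced = λ _ → 0
    ; produced-d = λ o → sym (+-identityʳ (outputs c o)) ; produced-end = λ o → sym (+-identityʳ (outputs c' o)) }
  replay {c} {c'} c∼c' (step e enabled r) = record
    { end          = Replay.end rest
    ; run          = step e (subst (0 <_) (same-pending c∼c' e) enabled) (Replay.run rest)
    ; end-∼        = Replay.end-∼ rest
    ; produced     = λ o → emit c o + Replay.produced rest o
    ; produced-d   = λ o → trans (Replay.produced-d rest o) (+-assoc (outputs c o) (emit c o) _)
    ; produced-end = λ o → trans (Replay.produced-end rest o)
        (trans (+-assoc (outputs c' o) (emit c' o) _)
               (cong (λ x → outputs c' o + (x + Replay.produced rest o)) (sym (emit-same o)))) }
    where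
      rest = replay (fire-∼ e c∼c') r
      emit : Config N → Fin nOut → ℕ
      emit x o = emitted N (head G e) (states x (head G e)) (e , refl) (inj₂ (inj₁ o))
      emit-same : ∀ o → emit c o ≡ emit c' o
      emit-same o = cong (λ s → emitted N (head G e) s (e , refl) (inj₂ (inj₁ o))) (same-states c∼c' (head G e))

  replay-≈ : ∀ {c c' d} → c ≈ c' → Reaches N c d → ∃ λ d' → Reaches N c' d' × d ≈ d'
  replay-≈ {c} {c'} {d} c≈c' r = Replay.end R , Replay.run R , record
    { core = Replay.end-∼ R
    ; same-outputs = λ o → trans (Replay.produced-d R o)
        (trans (cong (_+ Replay.produced R o) (same-outputs c≈c' o)) (sym (Replay.produced-end R o))) }
    where R = replay (core c≈c') r

  pending-fire-twice : ∀ c {e e'} e'' → 0 < pending c e → 0 < pending c e' → e' ≢ e →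
    pending (fire N (fire N c e) e') e'' + (δ e'' e' + δ e'' e)
      ≡ pending c e'' + (gain (states c) e e'' + gain (states (fire N c e)) e' e'')
  pending-fire-twice c {e} {e'} e'' e-enabled e'-enabled e'≢e = begin
      p₂ + (δ e'' e' + δ e'' e)    ≡⟨ sym (+-assoc p₂ (δ e'' e') (δ e'' e)) ⟩
      (p₂ + δ e'' e') + δ e'' e    ≡⟨ cong (_+ δ e'' e) (pending-fire-enabled (fire N c e) e' e''
                                         (≤-trans e'-enabled (fire-keeps c e'≢e))) ⟩
      (p₁ + g') + δ e'' e          ≡⟨ xy∙z≈xz∙y p₁ g' (δ e'' e) ⟩
      (p₁ + δ e'' e) + g'          ≡⟨ cong (_+ g') (pending-fire-enabled c e e'' e-enabled) ⟩
      (pending c e'' + g) + g'     ≡⟨ +-assoc (pending c e'') g g' ⟩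
      pending c e'' + (g + g')     ∎
    where
      open ≡-Reasoning
      p₁ = pending (fire N c e) e''
      p₂ = pending (fire N (fire N c e) e') e''
      g  = gain (states c) e e''
      g' = gain (states (fire N c e)) e' e''

  diamond : ∀ c {e e'} → 0 < pending c e → 0 < pending c e' → e' ≢ e →
            fire N (fire N c e) e' ≈ fire N (fire N c e') e
  diamond c {e} {e'} e-enabled e'-enabled e'≢e = record
    { core = record
      { same-states  = advance-comm (states c) (head G e) (head G e') (e , refl) (e' , refl)
      ; same-pending = λ e'' → +-cancelʳ-≡ (δ e'' e' + δ e'' e) _ _ (begin
          pending (fire N (fire N c e) e') e'' + (δ e'' e' + δ e'' e)
            ≡⟨ pending-fire-twice c e'' e-enabled e'-enabled e'≢e ⟩
          pending c e'' + (gain (states c) e e'' + gain (states (fire N c e)) e' e'')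
            ≡⟨ cong (pending c e'' +_) (gain-comm (states c) e e' e'') ⟩
          pending c e'' + (gain (states c) e' e'' + gain (states (fire N c e')) e e'')
            ≡⟨ sym (pending-fire-twice c e'' e'-enabled e-enabled (e'≢e ∘ sym)) ⟩
          pending (fire N (fire N c e') e) e'' + (δ e'' e + δ e'' e')
            ≡⟨ cong (pending (fire N (fire N c e') e) e'' +_) (+-comm (δ e'' e) (δ e'' e')) ⟩
          pending (fire N (fire N c e') e) e'' + (δ e'' e' + δ e'' e) ∎) }
    ; same-outputs = λ o → trans (+-assoc (outputs c o) _ _)
        (trans (cong (outputs c o +_) (emitted-comm (states c) (head G e) (head G e') (e , refl) (e' , refl) (inj₂ (inj₁ o))))
               (sym (+-assoc (outputs c o) _ _))) }
    where open ≡-Reasoning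

  -- Firing an enabled edge cannot lead away from a halting result: if c runs
  -- to the halted d, then so does fire c e, up to ≈.  (Induction on the run,
  -- closing each diamond with replay-≈.)
  fire-toward-halt : ∀ {c d} → Reaches N c d → Halted N d → ∀ {e} → 0 < pending c e →
                     ∃ λ d' → Reaches N (fire N c e) d' × d ≈ d'
  fire-toward-halt done halted {e} enabled = ⊥-elim (<⇒≢ enabled (sym (halted e)))
  fire-toward-halt {c} {d} (step e₀ e₀-enabled r) halted {e} enabled with ≡-dec _≟_ _≟_ e₀ e
  ... | yes refl = d , r , ≈-refl
  ... | no e₀≢e with fire-toward-halt r halted (≤-trans enabled (fire-keeps c (e₀≢e ∘ sym)))
  ...   | d₁ , r₁ , d≈d₁ with replay-≈ (diamond c e₀-enabled enabled (e₀≢e ∘ sym)) r₁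
  ...     | d₂ , r₂ , d₁≈d₂ = d₂ , step e₀ (≤-trans e₀-enabled (fire-keeps c e₀≢e)) r₂ , ≈-trans d≈d₁ d₁≈d₂

  halting-unique : ∀ {c d₁ d₂} → Reaches N c d₁ → Halted N d₁ → Reaches N c d₂ → Halted N d₂ → d₁ ≈ d₂
  halting-unique done               h₁ done         h₂ = ≈-refl
  halting-unique (step e enabled _) h₁ done         h₂ = ⊥-elim (<⇒≢ enabled (sym (h₂ e)))
  halting-unique r₁                 h₁ (step e enabled r₂) h₂ with fire-toward-halt r₁ h₁ enabled
  ... | d₁' , r₁' , d₁≈d₁' = ≈-trans d₁≈d₁' (halting-unique r₁' (halted-∼ (core d₁≈d₁') h₁) r₂ h₂)

  halting-unique-≈ : ∀ {c c' d d'} → c ≈ c' → Reaches N c d → Halted N d → Reaches N c' d' → Halted N d' → d ≈ d'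
  halting-unique-≈ c≈c' r h r' h' with replay-≈ c≈c' r
  ... | d'' , r'' , d≈d'' = ≈-trans d≈d'' (halting-unique r'' (halted-∼ (core d≈d'') h) r' h')

  continue-to-halt : ∀ {c d c'} → Reaches N c d → Halted N d → Reaches N c c' → ∃ λ d' → Reaches N c' d' × d ≈ d'
  continue-to-halt {d = d} r halted done = d , r , ≈-refl
  continue-to-halt r halted (step e enabled r') with fire-toward-halt r halted enabled
  ... | d₁ , r₁ , d≈d₁ with continue-to-halt r₁ (halted-∼ (core d≈d₁) halted) r'
  ...   | d₂ , r₂ , d₁≈d₂ = d₂ , r₂ , ≈-trans d≈d₁ d₁≈d₂

  _⊕_ : Config N → (HeadEdge G → ℕ) → Config N
  c ⊕ y = config (states c) (λ e → pending c e + y e) (outputs c) (trashed c)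

  fire-⊕ : ∀ c y e → 0 < pending c e → fire N (c ⊕ y) e ≈ fire N c e ⊕ y
  fire-⊕ c y e enabled = record
    { core = record
      { same-states  = λ _ → refl
      ; same-pending = λ e' → +-cancelʳ-≡ (δ e' e) _ _ (begin
          pending (fire N (c ⊕ y) e) e' + δ e' e  ≡⟨ pending-fire-enabled (c ⊕ y) e e' (≤-trans enabled (m≤m+n _ _)) ⟩
          (pending c e' + y e') + g e'            ≡⟨ xy∙z≈xz∙y (pending c e') (y e') (g e') ⟩
          (pending c e' + g e') + y e'            ≡⟨ cong (_+ y e') (sym (pending-fire-enabled c e e' enabled)) ⟩
          (pending (fire N c e) e' + δ e' e) + y e' ≡⟨ xy∙z≈xz∙y (pending (fire N c e) e') (δ e' e) (y e') ⟩
          (pending (fire N c e) e' + y e') + δ e' e ∎) }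
    ; same-outputs = λ _ → refl }
    where
      open ≡-Reasoning
      g : HeadEdge G → ℕ
      g e' = gain (states c) e e'

  ⊕-run : ∀ {c d} y → Reaches N c d → ∃ λ d' → Reaches N (c ⊕ y) d' × d' ≈ d ⊕ y
  ⊕-run {c} y done = c ⊕ y , done , ≈-refl
  ⊕-run {c} y (step e enabled r) with ⊕-run y r
  ... | d₁ , r₁ , d₁≈d⊕y with replay-≈ (≈-sym (fire-⊕ c y e enabled)) r₁
  ...   | d₂ , r₂ , d₁≈d₂ = d₂ , step e (≤-trans enabled (m≤m+n _ _)) r₂ , ≈-trans (≈-sym d₁≈d₂) d₁≈d⊕y

module SettledNetwork {G : Graph} (N : Network G) (halts : HaltsOnAllInputs N) where
  open Graph G
  open Network N
  open Confluence N

  Word : Set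
  Word = List (Fin nIn)

  settled : Word → Config N
  settled w = proj₁ (halts (occ w))

  settled-run : ∀ w → Reaches N (initConfig N (occ w)) (settled w)
  settled-run w = proj₁ (proj₂ (halts (occ w)))

  settled-halted : ∀ w → Halted N (settled w)
  settled-halted w = proj₂ (proj₂ (halts (occ w)))

  init-≈ : ∀ {x x'} → (∀ i → x i ≡ x' i) → initConfig N x ≈ initConfig N x'
  init-≈ {x} {x'} eq = record
    { core = record { same-states = λ _ → refl ; same-pending = same-pending-init }
    ; same-outputs = λ _ → refl }
    where
      same-pending-init : ∀ e → pending (initConfig N x) e ≡ pending (initConfig N x') e
      same-pending-init (inj₁ i) = eq i
      same-pending-init (inj₂ _) = refl

  settled-resp : ∀ w w' → (∀ i → occ w i ≡ occ w' i) → settled w ≈ settled w'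
  settled-resp w w' eq =
    halting-unique-≈ (init-≈ eq) (settled-run w) (settled-halted w) (settled-run w') (settled-halted w')

  letter : Fin nIn → HeadEdge G → ℕ
  letter a e = δ e (inj₁ a)

  init-∷ʳ : ∀ w a → initConfig N (occ (w ∷ʳ a)) ≈ initConfig N (occ w) ⊕ letter a
  init-∷ʳ w a = record
    { core = record { same-states = λ _ → refl ; same-pending = same-pending-∷ʳ }
    ; same-outputs = λ _ → refl }
    where
      same-pending-∷ʳ : ∀ e → pending (initConfig N (occ (w ∷ʳ a))) e ≡ pending (initConfig N (occ w) ⊕ letter a) e
      same-pending-∷ʳ (inj₁ i) = occ-∷ʳ w a i
      same-pending-∷ʳ (inj₂ _) = refl

  -- the network settles on w ∷ʳ a by first settling on w and then processing a
  settled-∷ʳ : ∀ w a → ∃ λ E → Reaches N (settled w ⊕ letter a) E × settled (w ∷ʳ a) ≈ E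
  settled-∷ʳ w a with ⊕-run (letter a) (settled-run w)
  ... | d₁ , r₁ , d₁≈settled⊕a with replay-≈ (≈-sym (init-∷ʳ w a)) r₁
  ... | d₂ , r₂ , d₁≈d₂ with continue-to-halt (settled-run (w ∷ʳ a)) (settled-halted (w ∷ʳ a)) r₂
  ... | E₀ , r₃ , settled≈E₀ with replay-≈ (≈-trans (≈-sym d₁≈d₂) d₁≈settled⊕a) r₃
  ... | E , r₄ , E₀≈E = E , r₄ , ≈-trans settled≈E₀ E₀≈E

  SameStates : Config N → Config N → Set
  SameStates c d = ∀ v → states c v ≡ states d v

  record Congruent (w w' : Word) (a : Fin nIn) : Set where
    field
      same-next    : SameStates (settled (w ∷ʳ a)) (settled (w' ∷ʳ a))
      increment    : Fin nOut → ℕ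
      increment-w  : OutputGain (settled w) increment (settled (w ∷ʳ a))
      increment-w' : OutputGain (settled w') increment (settled (w' ∷ʳ a))

  -- proof: replay the run processing a after w from the configuration settled on w'
  settled-congruence : ∀ w w' a → SameStates (settled w) (settled w') → Congruent w w' a
  settled-congruence w w' a same with settled-∷ʳ w a | settled-∷ʳ w' a
  ... | E , r , s≈E | E' , r' , s'≈E' = record
    { same-next    = λ v → trans (same-states (core s≈E) v) (trans (same-states (Replay.end-∼ R) v)
                       (trans (same-states (core end≈E') v) (sym (same-states (core s'≈E') v))))
    ; increment    = Replay.produced R
    ; increment-w  = λ o → trans (same-outputs s≈E o) (Replay.produced-d R o)
    ; increment-w' = λ o → trans (same-outputs s'≈E' o) (trans (sym (same-outputs end≈E' o)) (Replay.produced-end R o)) }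
    where
      start-∼ : settled w ⊕ letter a ∼ settled w' ⊕ letter a
      start-∼ = record
        { same-states  = same
        ; same-pending = λ e → cong (_+ letter a e) (trans (settled-halted w e) (sym (settled-halted w' e))) }
      R = replay start-∼ r
      -- the replayed run halts, hence ends where the network settles on w' ∷ʳ a
      end≈E' : Replay.end R ≈ E'
      end≈E' = halting-unique (Replay.run R)
        (halted-∼ (Replay.end-∼ R) (halted-∼ (core s≈E) (settled-halted (w ∷ʳ a))))
        r' (halted-∼ (core s'≈E') (settled-halted (w' ∷ʳ a)))

  code : Word → Fin (∏ nodes (λ v → Processor.size (proc v)))
  code w = encode (states (settled w))

  F : Word → Fin nOut → ℕ
  F w o = outputs (settled w) o

  Δ : Word → Fin nIn → Fin nOut → ℕ
  Δ w a o = F (w ∷ʳ a) o ∸ F w o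

  Δ-gain : ∀ w a {g} → OutputGain (settled w) g (settled (w ∷ʳ a)) → ∀ o → Δ w a o ≡ g o
  Δ-gain w a {g} produced-w o = trans (cong (_∸ F w o) (produced-w o)) (m+n∸m≡n (F w o) (g o))

  code-step : ∀ w w' a → code w ≡ code w' → code (w ∷ʳ a) ≡ code (w' ∷ʳ a)
  code-step w w' a eq = encode-cong (Congruent.same-next (settled-congruence w w' a (encode-injective _ _ eq)))

  Δ-resp : ∀ w w' a o → code w ≡ code w' → Δ w a o ≡ Δ w' a o
  Δ-resp w w' a o eq = trans (Δ-gain w a increment-w o) (sym (Δ-gain w' a increment-w' o))
    where open Congruent (settled-congruence w w' a (encode-injective _ _ eq))

  F-step : ∀ w a o → F (w ∷ʳ a) o ≡ F w o + Δ w a o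
  F-step w a o = trans (increment-w o) (cong (F w o +_) (sym (Δ-gain w a increment-w o)))
    where open Congruent (settled-congruence w w a (λ _ → refl))

  F-nil : ∀ o → F [] o ≡ 0
  F-nil = same-outputs (halting-unique (settled-run []) (settled-halted []) done initially-halted)
    where
      initially-halted : Halted N (initConfig N (occ []))
      initially-halted (inj₁ _) = refl
      initially-halted (inj₂ _) = refl

  code-swap : ∀ w a a' → code (w ∷ʳ a ∷ʳ a') ≡ code (w ∷ʳ a' ∷ʳ a)
  code-swap w a a' = encode-cong (same-states (core (settled-resp (w ∷ʳ a ∷ʳ a') (w ∷ʳ a' ∷ʳ a) (occ-swap w a a'))))

  F-swap : ∀ w a a' o → F (w ∷ʳ a ∷ʳ a') o ≡ F (w ∷ʳ a' ∷ʳ a) o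
  F-swap w a a' = same-outputs (settled-resp (w ∷ʳ a ∷ʳ a') (w ∷ʳ a' ∷ʳ a) (occ-swap w a a'))

  open QuotientProcessor code F Δ code-step Δ-resp F-step F-nil code-swap F-swap public
    using (processor; abelian; reachable; computes)

  emulates : Emulates N processor
  emulates x c run halted o = begin
      outputs c o          ≡⟨ same-outputs (halting-unique-≈ (init-≈ (λ i → sym (occ-canonWord x i)))
                                run halted (settled-run (canonWord x)) (settled-halted (canonWord x))) o ⟩
      F (canonWord x) o    ≡⟨ sym (computes (canonWord x) o) ⟩
      procFun processor x o ∎
    where open ≡-Reasoning

proposition2p6 : (G : Graph) (N : Network G) → HaltsOnAllInputs N →
    Σ (Processor (Fin (Graph.nIn G)) (Fin (Graph.nOut G)))
    (λ P → IsAbelian P × AllReachable P × Emulates N P)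
proposition2p6 G N halts = processor , abelian , reachable , emulates
  where open SettledNetwork N halts
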